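{- Let $\mathcal{S}$ be a realizability structure. Then $\mathrm{Th}(\mathcal{S})\models|\gimel_2|\le 4$ if and only if there is a proof-like term which computes parallel or modulo $\mathcal{S}$, i.e. a proof-like term realizing $\mathrm{POR}$ with respect to every pole of $\mathcal{S}$.
   Context: $\lambda_c$-calculus. Fix a countably infinite set of variables. $\lambda_c$-terms: $t,u ::= x \mid tu \mid \lambda x.t \mid \mathrm{cc} \mid k_\pi$ ($\pi$ a stack) $\mid \kappa_m$ ($m\in\mathbb{N}$, non-restricted instructions) $\mid \beta_m$ ($m\in\mathbb{N}$, restricted instructions), modulo $\alpha$-equivalence. A term is a closed $\lambda_c$-term; $\Lambda$ is the set of terms. Stacks: $\pi ::= \omega_m \mid t\cdot\pi$ ($t\in\Lambda$); $\Pi$ is the set of stacks. Processes: $t\star\pi$. One-step evaluation $\succ_1$: $tu\star\pi \succ_1 t\star u\cdot\pi$, $\lambda x.t\star u\cdot\pi\succ_1 t[x:=u]\star\pi$, $\mathrm{cc}\star t\cdot\pi\succ_1 t\star k_\pi\cdot\pi$, $k_{\pi'}\star t\cdot\pi\succ_1 t\star\pi'$; $\succ$ is its reflexive-transitive closure. A pole is a set $\perp\!\!\!\perp$ of processes with $p\succ q$, $q\in\perp\!\!\!\perp\Rightarrow p\in\perp\!\!\!\perp$. A term is proof-like if it contains no $k_\pi$ and no restricted instruction. Formulas. First-order terms: $a ::= x \mid f(a_1,\dots,a_k)$ ($f:\mathbb{N}^k\to\mathbb{N}$). Formulas: $X(a_1,\dots,a_k)\mid\top\mid\bot\mid A\to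 B\mid\forall x A\mid\forall X A\mid(a=b)\hookrightarrow A\mid A\cap B\mid A\cup B\mid F(a_1,\dots,a_k)$ ($F:\mathbb{N}^k\to\mathcal{P}(\Pi)$). Given a pole: $\|\top\|=\emptyset$, $\|\bot\|=\Pi$, $\|A\to B\|=\{t\cdot\pi:t\in|A|,\pi\in\|B\|\}$, $\|\forall xA\|=\bigcup_m\|A[x:=m]\|$, $\|\forall XA\|=\bigcup_F\|A[X:=F]\|$ over all $F:\mathbb{N}^k\to\mathcal{P}(\Pi)$, $\|(a=b)\hookrightarrow A\|=\|A\|$ if the values of $a,b$ are equal else $\emptyset$, $\|A\cap B\|=\|A\|\cup\|B\|$, $\|A\cup B\|=\|A\|\cap\|B\|$, $\|F(\vec a)\|=F(\text{values})$; $|A|=\{t:\forall\pi\in\|A\|,t\star\pi\in\perp\!\!\!\perp\}$; $t$ realizes $A$ if $t\in|A|$. Abbreviations: $a=b$ is $\forall Z(Z(a)\to Z(b))$; $a\ne b$ is $(a=b)\hookrightarrow\bot$; $A\vee B$ is $\forall Z((A\to Z)\to(B\to Z)\to Z)$. A realizability structure is a set $\mathcal{S}$ of poles; $\mathrm{Th}(\mathcal{S})$ is the set of closed formulas realized w.r.t. every pole of $\mathcal{S}$ by a single proof-like term; $\mathrm{Th}(\mathcal{S})\models A$ means $A\in\mathrm{Th}(\mathcal{S})$. $\mathrm{Bool}(y)$ is $\forall X(X(0)\to X(1)\to X(y))$; $\mathrm{POR}$ is $(\mathrm{Bool}(1)\to\top\to\mathrm{Bool}(1))\cap(\top\to\mathrm{Bool}(1)\to\mathrm{Bool}(1))\cap(\mathrm{Bool}(0)\to\mathrm{Bool}(0)\to\mathrm{Bool}(0))$.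 $\gimel_2(a)$ is the formula $\min(a+1,2)=a+1$; $|\gimel_2|\le 4$ denotes the formula $\forall x_1\dots\forall x_5\ (\gimel_2(x_1)\hookrightarrow\cdots\hookrightarrow\gimel_2(x_5)\hookrightarrow\bigvee_{i\neq j}(x_i=x_j))$. -}

module Defs where

open import Level using (Level; Lift; lift) renaming (suc to lsuc; zero to lzero)
open import Data.Nat using (ℕ; zero; suc; _+_; _⊓_)
open import Data.Fin using (Fin; zero; suc)
open import Data.Product using (Σ; _×_; _,_)
open import Data.Sum using (_⊎_)
open import Data.Empty using (⊥)
open import Data.Unit using (⊤)
open import Relation.Binary.PropositionalEquality using (_≡_)
open import Relation.Binary.Construct.Closure.ReflexiveTransitive using (Star)

-- λc-terms (de Bruijn indices, so α-equivalence is syntactic equality).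
-- Term n = λc-terms with at most n free variables; closed terms = Term 0.

data Stack : Set
data Term (n : ℕ) : Set

data Term n where
  var : Fin n → Term n
  app : Term n → Term n → Term n
  lam : Term (suc n) → Term n
  cc  : Term n
  k   : Stack → Term n
  κ   : ℕ → Term n
  β   : ℕ → Term n

data Stack where
  ω   : ℕ → Stack
  _•_ : Term 0 → Stack → Stack

infixr 5 _•_

Λ : Set
Λ = Term 0

ext : ∀ {m n} → (Fin m → Fin n) → Fin (suc m) → Fin (suc n)
ext ρ zero    = zero
ext ρ (suc i) = suc (ρ i)

rename : ∀ {m n} → (Fin m → Fin n) → Term m → Term n
rename ρ (var i)   = var (ρ i)
rename ρ (app t u) = app (rename ρ t) (rename ρ u)
rename ρ (lam t)   = lam (rename (ext ρ) t)
rename ρ cc        = cc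
rename ρ (k π)     = k π
rename ρ (κ m)     = κ m
rename ρ (β m)     = β m

exts : ∀ {m n} → (Fin m → Term n) → Fin (suc m) → Term (suc n)
exts σ zero    = var zero
exts σ (suc i) = rename suc (σ i)

subst : ∀ {m n} → (Fin m → Term n) → Term m → Term n
subst σ (var i)   = σ i
subst σ (app t u) = app (subst σ t) (subst σ u)
subst σ (lam t)   = lam (subst (exts σ) t)
subst σ cc        = cc
subst σ (k π)     = k π
subst σ (κ m)     = κ m
subst σ (β m)     = β m

_[_] : Term 1 → Λ → Λ
t [ u ] = subst (λ { zero → u }) t

record Process : Set where
  constructor _★_
  field
    term  : Λ
    stack : Stack

infix 4 _★_

data _≻₁_ : Process → Process → Set where
  push    : ∀ {t u π}    → (app t u ★ π) ≻₁ (t ★ u • π)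
  grab    : ∀ {t u π}    → (lam t ★ u • π) ≻₁ (t [ u ] ★ π)
  save    : ∀ {t π}      → (cc ★ t • π) ≻₁ (t ★ k π • π)
  restore : ∀ {π' t π}   → (k π' ★ t • π) ≻₁ (t ★ π')

_≻_ : Process → Process → Set
_≻_ = Star _≻₁_

record Pole : Set₁ where
  field
    ⊥⊥     : Process → Set
    closed : ∀ {p q} → p ≻ q → ⊥⊥ q → ⊥⊥ p

data ProofLike {n : ℕ} : Term n → Set where
  var : ∀ i → ProofLike (var i)
  app : ∀ {t u} → ProofLike t → ProofLike u → ProofLike (app t u)
  lam : ∀ {t} → ProofLike t → ProofLike (lam t)
  cc  : ProofLike cc
  κ   : ∀ m → ProofLike (κ m)

-- Formulas, interpreted (shallowly) by their falsity values ‖A‖ ⊆ Π.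
-- Second-order variables of arity k range over F : ℕ^k → P(Π),
-- first-order variables range over ℕ; substitution is Agda application.

FV : Set₂
FV = Stack → Set₁

PredVar : ℕ → Set₁
PredVar j = (Fin j → ℕ) → Stack → Set

module Realizability (P : Pole) where
  open Pole P

  ∣_∣ : FV → Λ → Set₁
  ∣ A ∣ t = ∀ π → A π → ⊥⊥ (t ★ π)

  ‖⊤‖ : FV
  ‖⊤‖ _ = Lift (lsuc lzero) ⊥

  ‖⊥‖ : FV
  ‖⊥‖ _ = Lift (lsuc lzero) ⊤

  at : ∀ {j} → PredVar j → (Fin j → ℕ) → FV
  at F as π = Lift (lsuc lzero) (F as π)

  infixr 4 _⇒_
  _⇒_ : FV → FV → FV
  (A ⇒ B) π = Σ Λ λ t → Σ Stack λ ρ → Lift (lsuc lzero) (π ≡ t • ρ) × ∣ A ∣ t × B ρ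

  ∀¹ : (ℕ → FV) → FV
  ∀¹ Φ π = Σ ℕ λ m → Φ m π

  ∀² : ∀ j → (PredVar j → FV) → FV
  ∀² j Φ π = Σ (PredVar j) λ F → Φ F π

  _≐_↪_ : ℕ → ℕ → FV → FV
  (a ≐ b ↪ A) π = Lift (lsuc lzero) (a ≡ b) × A π

  _∩_ : FV → FV → FV
  (A ∩ B) π = A π ⊎ B π

  _∪_ : FV → FV → FV
  (A ∪ B) π = A π × B π

  unary : ℕ → Fin 1 → ℕ
  unary a zero = a

  nullary : Fin 0 → ℕ
  nullary ()

  _≗_ : ℕ → ℕ → FV
  a ≗ b = ∀² 1 λ Z → at Z (unary a) ⇒ at Z (unary b)

  _∨_ : FV → FV → FV
  A ∨ B = ∀² 0 λ Z → (A ⇒ at Z nullary) ⇒ (B ⇒ at Z nullary) ⇒ at Z nullary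

  infixr 3 _∨_

  Bool : ℕ → FV
  Bool y = ∀² 1 λ X → at X (unary 0) ⇒ at X (unary 1) ⇒ at X (unary y)

  POR : FV
  POR = ((Bool 1 ⇒ ‖⊤‖ ⇒ Bool 1) ∩ (‖⊤‖ ⇒ Bool 1 ⇒ Bool 1))
        ∩ (Bool 0 ⇒ Bool 0 ⇒ Bool 0)

  ℷ₂_↪_ : ℕ → FV → FV
  ℷ₂ a ↪ A = ((a + 1) ⊓ 2) ≐ (a + 1) ↪ A

  ℷ₂≤4 : FV
  ℷ₂≤4 = ∀¹ λ x₁ → ∀¹ λ x₂ → ∀¹ λ x₃ → ∀¹ λ x₄ → ∀¹ λ x₅ →
    ℷ₂ x₁ ↪ ℷ₂ x₂ ↪ ℷ₂ x₃ ↪ ℷ₂ x₄ ↪ ℷ₂ x₅ ↪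
      ( (x₁ ≗ x₂) ∨ (x₁ ≗ x₃) ∨ (x₁ ≗ x₄) ∨ (x₁ ≗ x₅)
      ∨ (x₂ ≗ x₃) ∨ (x₂ ≗ x₄) ∨ (x₂ ≗ x₅)
      ∨ (x₃ ≗ x₄) ∨ (x₃ ≗ x₅)
      ∨ (x₄ ≗ x₅) )

RealizabilityStructure : Set₂
RealizabilityStructure = Pole → Set₁

Formula : Set₂
Formula = Pole → FV

_⊨_ : RealizabilityStructure → Formula → Set₁
𝒮 ⊨ A = Σ Λ λ t → ProofLike t × (∀ P → 𝒮 P → Realizability.∣_∣ P (A P) t)

PORformula : Formula
PORformula P = Realizability.POR P

ℷ₂≤4formula : Formula
ℷ₂≤4formula P = Realizability.ℷ₂≤4 P

module Submission where

-- Here ℷ₂(x) holds exactly for x ∈ {0,1}, so |ℷ₂| ≤ 4 says: among five bits two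
-- are equal.  Its matrix is a tenfold disjunction  ⋁_{p} (x_{first p} = x_{second p}).
--
-- (⇐) Given θ realizing POR, the three clauses of POR say that θ u v u w behaves
-- like a "majority gate" on the realizers of ⊥.  A proof-like term grabs the
-- current continuation k with cc and evaluates a fixed majority circuit whose
-- leaves are k (inject p Id), the canonical proof of the p-th disjunct.  The
-- circuit is checked by computation to be true on all 32 five-bit inputs; since
-- true leaves are exactly the equal pairs, some true leaf throws to k.
--
-- (⇒) Given τ realizing |ℷ₂| ≤ 4, a refutation of POR exposes three candidate
-- terms b, u a b, v a b, two of which are in the pole at the current stack
-- (which two depends on the clause).  For each clause we feed τ a colouring of
-- the five points for which every monochromatic pair is labelled by a usable
-- candidate; the handler of pair p runs the candidate labelling p.

open import Defs
open import Data.Bool using (T; true; false; _∧_) renaming (Bool to 𝔹)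
open import Data.Empty using (⊥-elim)
open import Data.Fin using (Fin; zero; suc; toℕ; #_)
open import Data.Fin.Properties using (all?)
open import Data.Nat using (ℕ; zero; suc; _+_; _⊓_; _≡ᵇ_; s≤s)
open import Data.Nat.Properties using (_≟_; ≡ᵇ⇒≡; m⊓n≡m⇒m≤n; m+n≤o⇒n≤o)
open import Data.Product using (Σ; _×_; _,_)
open import Data.Sum using (inj₁; inj₂)
open import Data.Unit using (tt)
open import Data.Vec.Functional using ([]; _∷_)
open import Level using (lift)
open import Relation.Binary.PropositionalEquality
  using (_≡_; _≢_; refl; sym; trans; cong; cong₂) renaming (subst to transport)
open import Relation.Binary.Construct.Closure.ReflexiveTransitive using (ε; _◅_; _◅◅_)
open import Relation.Binary.Definitions using (DecidableEquality)
open import Relation.Nullary using (Dec; yes; no)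
open import Relation.Nullary.Decidable using (toWitness; T?; ¬?; _→-dec_)

ext-cong : ∀ {m n} {ρ ρ' : Fin m → Fin n} → (∀ i → ρ i ≡ ρ' i) → ∀ i → ext ρ i ≡ ext ρ' i
ext-cong h zero    = refl
ext-cong h (suc i) = cong suc (h i)

rename-cong : ∀ {m n} {ρ ρ' : Fin m → Fin n} → (∀ i → ρ i ≡ ρ' i) → ∀ t → rename ρ t ≡ rename ρ' t
rename-cong h (var i)   = cong var (h i)
rename-cong h (app t u) = cong₂ app (rename-cong h t) (rename-cong h u)
rename-cong h (lam t)   = cong lam (rename-cong (ext-cong h) t)
rename-cong h cc        = refl
rename-cong h (k π)     = refl
rename-cong h (κ m)     = refl
rename-cong h (β m)     = refl

exts-cong : ∀ {m n} {σ σ' : Fin m → Term n} → (∀ i → σ i ≡ σ' i) → ∀ i → exts σ i ≡ exts σ' i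
exts-cong h zero    = refl
exts-cong h (suc i) = cong (rename suc) (h i)

subst-cong : ∀ {m n} {σ σ' : Fin m → Term n} → (∀ i → σ i ≡ σ' i) → ∀ t → subst σ t ≡ subst σ' t
subst-cong h (var i)   = h i
subst-cong h (app t u) = cong₂ app (subst-cong h t) (subst-cong h u)
subst-cong h (lam t)   = cong lam (subst-cong (exts-cong h) t)
subst-cong h cc        = refl
subst-cong h (k π)     = refl
subst-cong h (κ m)     = refl
subst-cong h (β m)     = refl

rename-rename : ∀ {l m n} (ρ : Fin m → Fin n) (ρ' : Fin l → Fin m) t →
  rename ρ (rename ρ' t) ≡ rename (λ i → ρ (ρ' i)) t
rename-rename ρ ρ' (var i)   = refl
rename-rename ρ ρ' (app t u) = cong₂ app (rename-rename ρ ρ' t) (rename-rename ρ ρ' u)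
rename-rename ρ ρ' (lam t)   = cong lam (trans (rename-rename (ext ρ) (ext ρ') t) (rename-cong ext-ext t))
  where
  ext-ext : ∀ i → ext ρ (ext ρ' i) ≡ ext (λ j → ρ (ρ' j)) i
  ext-ext zero    = refl
  ext-ext (suc i) = refl
rename-rename ρ ρ' cc    = refl
rename-rename ρ ρ' (k π) = refl
rename-rename ρ ρ' (κ m) = refl
rename-rename ρ ρ' (β m) = refl

subst-rename : ∀ {l m n} (σ : Fin m → Term n) (ρ : Fin l → Fin m) t →
  subst σ (rename ρ t) ≡ subst (λ i → σ (ρ i)) t
subst-rename σ ρ (var i)   = refl
subst-rename σ ρ (app t u) = cong₂ app (subst-rename σ ρ t) (subst-rename σ ρ u)
subst-rename σ ρ (lam t)   = cong lam (trans (subst-rename (exts σ) (ext ρ) t) (subst-cong exts-ext t))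
  where
  exts-ext : ∀ i → exts σ (ext ρ i) ≡ exts (λ j → σ (ρ j)) i
  exts-ext zero    = refl
  exts-ext (suc i) = refl
subst-rename σ ρ cc    = refl
subst-rename σ ρ (k π) = refl
subst-rename σ ρ (κ m) = refl
subst-rename σ ρ (β m) = refl

rename-subst : ∀ {l m n} (ρ : Fin m → Fin n) (σ : Fin l → Term m) t →
  rename ρ (subst σ t) ≡ subst (λ i → rename ρ (σ i)) t
rename-subst ρ σ (var i)   = refl
rename-subst ρ σ (app t u) = cong₂ app (rename-subst ρ σ t) (rename-subst ρ σ u)
rename-subst ρ σ (lam t)   = cong lam (trans (rename-subst (ext ρ) (exts σ) t) (subst-cong ext-exts t))
  where
  ext-exts : ∀ i → rename (ext ρ) (exts σ i) ≡ exts (λ j → rename ρ (σ j)) i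
  ext-exts zero    = refl
  ext-exts (suc i) = trans (rename-rename (ext ρ) suc (σ i)) (sym (rename-rename suc ρ (σ i)))
rename-subst ρ σ cc    = refl
rename-subst ρ σ (k π) = refl
rename-subst ρ σ (κ m) = refl
rename-subst ρ σ (β m) = refl

subst-subst : ∀ {l m n} (τ : Fin m → Term n) (σ : Fin l → Term m) t →
  subst τ (subst σ t) ≡ subst (λ i → subst τ (σ i)) t
subst-subst τ σ (var i)   = refl
subst-subst τ σ (app t u) = cong₂ app (subst-subst τ σ t) (subst-subst τ σ u)
subst-subst τ σ (lam t)   = cong lam (trans (subst-subst (exts τ) (exts σ) t) (subst-cong exts-exts t))
  where
  exts-exts : ∀ i → subst (exts τ) (exts σ i) ≡ exts (λ j → subst τ (σ j)) i
  exts-exts zero    = refl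
  exts-exts (suc i) = trans (subst-rename (exts τ) suc (σ i)) (sym (rename-subst suc τ (σ i)))
subst-subst τ σ cc    = refl
subst-subst τ σ (k π) = refl
subst-subst τ σ (κ m) = refl
subst-subst τ σ (β m) = refl

subst-var : ∀ {n} (t : Term n) → subst var t ≡ t
subst-var (var i)   = refl
subst-var (app t u) = cong₂ app (subst-var t) (subst-var u)
subst-var (lam t)   = cong lam (trans (subst-cong exts-var t) (subst-var t))
  where
  exts-var : ∀ i → exts var i ≡ var i
  exts-var zero    = refl
  exts-var (suc i) = refl
subst-var cc    = refl
subst-var (k π) = refl
subst-var (κ m) = refl
subst-var (β m) = refl

exts-then-instantiate : ∀ {n} (σ : Fin n → Λ) (t : Term (suc n)) u →
  (subst (exts σ) t) [ u ] ≡ subst (u ∷ σ) t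
exts-then-instantiate σ t u = trans (subst-subst _ (exts σ) t) (subst-cong agree t)
  where
  agree : ∀ i → (exts σ i) [ u ] ≡ (u ∷ σ) i
  agree zero    = refl
  agree (suc i) = trans (subst-rename _ suc (σ i)) (trans (subst-cong (λ ()) (σ i)) (subst-var (σ i)))

β-closed : ∀ (t : Term 1) u π → (lam t ★ u • π) ≻ (subst (u ∷ []) t ★ π)
β-closed t u π = transport (λ s → (lam t ★ u • π) ≻ (s ★ π)) (subst-cong (λ { zero → refl }) t) (grab ◅ ε)

β-env : ∀ {n} (σ : Fin n → Λ) t u π → (subst σ (lam t) ★ u • π) ≻ (subst (u ∷ σ) t ★ π)
β-env σ t u π = transport (λ s → (subst σ (lam t) ★ u • π) ≻ (s ★ π)) (exts-then-instantiate σ t u) (grab ◅ ε)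

β₂ : ∀ (t : Term 2) a b π → (lam (lam t) ★ a • b • π) ≻ (subst (b ∷ a ∷ []) t ★ π)
β₂ t a b π = β-closed (lam t) a (b • π) ◅◅ β-env _ t b π

β₃ : ∀ (t : Term 3) a b c π → (lam (lam (lam t)) ★ a • b • c • π) ≻ (subst (c ∷ b ∷ a ∷ []) t ★ π)
β₃ t a b c π = β₂ (lam t) a b (c • π) ◅◅ β-env _ t c π

β₅ : ∀ (t : Term 5) a b c d e π →
  (lam (lam (lam (lam (lam t)))) ★ a • b • c • d • e • π) ≻ (subst (e ∷ d ∷ c ∷ b ∷ a ∷ []) t ★ π)
β₅ t a b c d e π = β₃ (lam (lam t)) a b c (d • e • π) ◅◅ β-env _ (lam t) d (e • π) ◅◅ β-env _ t e π

-- Combinators.  They are closed, but typed in every context so that they can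
-- occur inside open terms; substitution leaves them unchanged by computation.

v0 : ∀ {n} → Term (suc n)
v0 = var zero

v1 : ∀ {n} → Term (suc (suc n))
v1 = var (suc zero)

v2 : ∀ {n} → Term (suc (suc (suc n)))
v2 = var (suc (suc zero))

v3 : ∀ {n} → Term (suc (suc (suc (suc n))))
v3 = var (suc (suc (suc zero)))

v4 : ∀ {n} → Term (suc (suc (suc (suc (suc n)))))
v4 = var (suc (suc (suc (suc zero))))

Id : ∀ {n} → Term n
Id = lam v0

-- λc.λe. e c
Feed : ∀ {n} → Term n
Feed = lam (lam (app v0 v1))

-- λf.λg.λr. r f g
Case : ∀ {n} → Term n
Case = lam (lam (lam (app (app v0 v2) v1)))

-- λw.λf.λg. f w   and   λw.λf.λg. g w
Inl Inr : ∀ {n} → Term n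
Inl = lam (lam (lam (app v1 v2)))
Inr = lam (lam (lam (app v0 v2)))

-- inject n i w : the canonical proof of A₀ ∨ (… ∨ Aₙ) built from a proof w of Aᵢ.
inject : ∀ {m} n → Fin (suc n) → Term m → Term m
inject zero    zero    w = w
inject (suc n) zero    w = app Inl w
inject (suc n) (suc i) w = app Inr (inject n i w)

-- cases n h : eliminates A₀ ∨ (… ∨ Aₙ) with the handler h i for the disjunct Aᵢ.
cases : ∀ {m} n → (Fin (suc n) → Term m) → Term m
cases zero    h = h zero
cases (suc n) h = app (app Case (h zero)) (cases n (λ i → h (suc i)))

-- The gate θ u v a b; applied to a POR-realizer θ as  θ A B A C  it computes majority.
gate : ∀ {m} → Term m → Term m → Term m → Term m → Term m → Term m
gate θ u v a b = app (app (app (app θ u) v) a) b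

data Maj (V : Set) : Set where
  input : V → Maj V
  maj   : Maj V → Maj V → Maj V → Maj V

majority : 𝔹 → 𝔹 → 𝔹 → 𝔹
majority true  true  c = true
majority true  false c = c
majority false true  c = c
majority false false c = false

evaluate : ∀ {V} → Maj V → (V → 𝔹) → 𝔹
evaluate (input p)   v = v p
evaluate (maj F G H) v = majority (evaluate F v) (evaluate G v) (evaluate H v)

circuit : ∀ {m V} → Term m → (V → Term m) → Maj V → Term m
circuit θ ℓ (input p)   = ℓ p
circuit θ ℓ (maj F G H) = gate θ (circuit θ ℓ F) (circuit θ ℓ G) (circuit θ ℓ F) (circuit θ ℓ H)

-- choose n F θ grabs its continuation k and evaluates the circuit F on the inputs
-- k (inject n p Id), which hand the canonical proof of the p-th disjunct to k.
choose : ∀ n → Maj (Fin (suc n)) → Λ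
choose n F = lam (app cc (lam (circuit v1 (λ p → app v0 (inject n p Id)) F)))

subst-inject : ∀ {m n} (σ : Fin m → Term n) l i w → subst σ (inject l i w) ≡ inject l i (subst σ w)
subst-inject σ zero    zero    w = refl
subst-inject σ (suc l) zero    w = refl
subst-inject σ (suc l) (suc i) w = cong (app Inr) (subst-inject σ l i w)

subst-circuit : ∀ {m n V} (σ : Fin m → Term n) θ (ℓ : V → Term m) F →
  subst σ (circuit θ ℓ F) ≡ circuit (subst σ θ) (λ p → subst σ (ℓ p)) F
subst-circuit σ θ ℓ (input p)   = refl
subst-circuit σ θ ℓ (maj F G H) =
  cong₂ app (cong₂ app (cong₂ app (cong (app (subst σ θ)) F′) (subst-circuit σ θ ℓ G)) F′) (subst-circuit σ θ ℓ H)
  where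
  F′ : subst σ (circuit θ ℓ F) ≡ circuit (subst σ θ) (λ p → subst σ (ℓ p)) F
  F′ = subst-circuit σ θ ℓ F

-- Proof-likeness is decidable; concrete terms are checked by computation.
isProofLike : ∀ {n} → Term n → 𝔹
isProofLike (var i)   = true
isProofLike (app t u) = isProofLike t ∧ isProofLike u
isProofLike (lam t)   = isProofLike t
isProofLike cc        = true
isProofLike (k π)     = false
isProofLike (κ m)     = true
isProofLike (β m)     = false

isProofLike-sound : ∀ {n} (t : Term n) → T (isProofLike t) → ProofLike t
isProofLike-sound (var i)   _ = var i
isProofLike-sound (app t u) h with isProofLike t | isProofLike-sound t | isProofLike-sound u
... | true | t-ok | u-ok = app (t-ok tt) (u-ok h)
isProofLike-sound (lam t)   h = lam (isProofLike-sound t h)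
isProofLike-sound cc        _ = cc
isProofLike-sound (κ m)     _ = κ m

module RealizabilityLemmas (P : Pole) where
  open Pole P
  open Realizability P

  Realizes⊥ : Λ → Set
  Realizes⊥ t = ∀ π → ⊥⊥ (t ★ π)

  realizes-any : ∀ {A t} → Realizes⊥ t → ∣ A ∣ t
  realizes-any t⊥ π _ = t⊥ π

  throw : ∀ {t ρ} → ⊥⊥ (t ★ ρ) → Realizes⊥ (app (k ρ) t)
  throw tρ π = closed (push ◅ restore ◅ ε) tρ

  ⋁ : ∀ n → (Fin (suc n) → FV) → FV
  ⋁ zero    A = A zero
  ⋁ (suc n) A = A zero ∨ ⋁ n (λ i → A (suc i))

  inl-realizes : ∀ {A B w} → ∣ A ∣ w → ∣ A ∨ B ∣ (app Inl w)
  inl-realizes {w = w} wA _ (_ , f , _ , lift refl , fr , (g , ρ , lift refl , _ , zρ)) =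
    closed (push ◅ β₃ _ w f g ρ ◅◅ push ◅ ε) (fr _ (w , ρ , lift refl , wA , zρ))

  inr-realizes : ∀ {A B w} → ∣ B ∣ w → ∣ A ∨ B ∣ (app Inr w)
  inr-realizes {w = w} wB _ (_ , f , _ , lift refl , _ , (g , ρ , lift refl , gr , zρ)) =
    closed (push ◅ β₃ _ w f g ρ ◅◅ push ◅ ε) (gr _ (w , ρ , lift refl , wB , zρ))

  inject-realizes : ∀ n {A : Fin (suc n) → FV} i {w} → ∣ A i ∣ w → ∣ ⋁ n A ∣ (inject n i w)
  inject-realizes zero    zero    wA = wA
  inject-realizes (suc n) zero    wA = inl-realizes wA
  inject-realizes (suc n) (suc i) wA = inr-realizes (inject-realizes n i wA)

  case-realizes : ∀ {A B Z f g} → ∣ A ⇒ at Z nullary ∣ f → ∣ B ⇒ at Z nullary ∣ g →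
    ∣ (A ∨ B) ⇒ at Z nullary ∣ (app (app Case f) g)
  case-realizes {Z = Z} {f} {g} fr gr _ (r , σ , lift refl , rr , zσ) =
    closed (push ◅ push ◅ β₃ _ f g r σ ◅◅ push ◅ push ◅ ε)
      (rr _ (Z , f , _ , lift refl , fr , (g , σ , lift refl , gr , zσ)))

  cases-realizes : ∀ n {A : Fin (suc n) → FV} {Z} h → (∀ i → ∣ A i ⇒ at Z nullary ∣ (h i)) →
    ∣ ⋁ n A ⇒ at Z nullary ∣ (cases n h)
  cases-realizes zero            h hr = hr zero
  cases-realizes (suc n) {Z = Z} h hr =
    case-realizes {Z = Z} (hr zero) (cases-realizes n {Z = Z} (λ i → h (suc i)) (λ i → hr (suc i)))

  refl-realizes : ∀ {x y} → x ≡ y → ∣ x ≗ y ∣ Id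
  refl-realizes refl _ (_ , t , ρ , lift refl , tr , zρ) = closed (grab ◅ ε) (tr ρ zρ)

  Only : Stack → PredVar 0
  Only ρ _ π = π ≡ ρ

  -- Feed c proves x = y → Only ρ as soon as c ★ ρ is in the pole whenever x ≡ y:
  -- a false equation is refuted by the predicate separating x from y.
  feed-realizes : ∀ {x y} ρ c → (x ≡ y → ⊥⊥ (c ★ ρ)) → ∣ (x ≗ y) ⇒ at (Only ρ) nullary ∣ (app Feed c)
  feed-realizes {x} {y} ρ c good _ (e , _ , lift refl , er , lift refl) =
    closed (push ◅ β₂ _ c e ρ ◅◅ push ◅ ε) (er _ (equation (x ≟ y)))
    where
    equation : Dec (x ≡ y) → (x ≗ y) (c • ρ)
    equation (yes refl) = (λ _ π → π ≡ ρ) , c , ρ , lift refl , (λ { _ (lift refl) → good refl }) , lift refl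
    equation (no x≢y)   = (λ v _ → v zero ≡ y) , c , ρ , lift refl , (λ { _ (lift x≡y) → ⊥-elim (x≢y x≡y) }) , lift refl

  bool-elim : ∀ {y u a b ρ} (X : PredVar 1) → ∣ Bool y ∣ u →
    ∣ at X (unary 0) ∣ a → ∣ at X (unary 1) ∣ b → at X (unary y) ρ → ⊥⊥ (app (app u a) b ★ ρ)
  bool-elim X ur ar br xρ = closed (push ◅ push ◅ ε) (ur _ (X , _ , _ , lift refl , ar , (_ , _ , lift refl , br , xρ)))

  -- The three clauses of POR, read as closure properties of the realizers of ⊥.
  module PorGates {θ} (θr : ∣ POR ∣ θ) where
    Is : ℕ → PredVar 1
    Is n y _ = y zero ≡ n

    por-left : ∀ {u v a b} → Realizes⊥ u → Realizes⊥ b → Realizes⊥ (gate θ u v a b)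
    por-left {u} {v} {a} {b} u⊥ b⊥ ρ = closed (push ◅ push ◅ push ◅ push ◅ ε)
      (θr _ (inj₁ (inj₁ (u , _ , lift refl , realizes-any u⊥ , (v , _ , lift refl , (λ _ ()) ,
        (Is 1 , a , _ , lift refl , (λ _ ()) , (b , ρ , lift refl , realizes-any b⊥ , lift refl)))))))

    por-right : ∀ {u v a b} → Realizes⊥ v → Realizes⊥ b → Realizes⊥ (gate θ u v a b)
    por-right {u} {v} {a} {b} v⊥ b⊥ ρ = closed (push ◅ push ◅ push ◅ push ◅ ε)
      (θr _ (inj₁ (inj₂ (u , _ , lift refl , (λ _ ()) , (v , _ , lift refl , realizes-any v⊥ ,
        (Is 1 , a , _ , lift refl , (λ _ ()) , (b , ρ , lift refl , realizes-any b⊥ , lift refl)))))))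

    por-both : ∀ {u v a b} → Realizes⊥ u → Realizes⊥ v → Realizes⊥ a → Realizes⊥ (gate θ u v a b)
    por-both {u} {v} {a} {b} u⊥ v⊥ a⊥ ρ = closed (push ◅ push ◅ push ◅ push ◅ ε)
      (θr _ (inj₂ (u , _ , lift refl , realizes-any u⊥ , (v , _ , lift refl , realizes-any v⊥ ,
        (Is 0 , a , _ , lift refl , realizes-any a⊥ , (b , ρ , lift refl , (λ _ ()) , lift refl))))))

    majority-realizes : ∀ {A B C} a b c → (T a → Realizes⊥ A) → (T b → Realizes⊥ B) → (T c → Realizes⊥ C) →
      T (majority a b c) → Realizes⊥ (gate θ A B A C)
    majority-realizes true  true  c    A⊥ B⊥ C⊥ _ = por-both (A⊥ tt) (B⊥ tt) (A⊥ tt)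
    majority-realizes true  false true A⊥ B⊥ C⊥ _ = por-left (A⊥ tt) (C⊥ tt)
    majority-realizes false true  true A⊥ B⊥ C⊥ _ = por-right (B⊥ tt) (C⊥ tt)

    circuit-realizes : ∀ {V} {ℓ : V → Λ} (v : V → 𝔹) → (∀ p → T (v p) → Realizes⊥ (ℓ p)) →
      ∀ F → T (evaluate F v) → Realizes⊥ (circuit θ ℓ F)
    circuit-realizes v inputs (input p)   = inputs p
    circuit-realizes v inputs (maj F G H) =
      majority-realizes (evaluate F v) (evaluate G v) (evaluate H v)
        (circuit-realizes v inputs F) (circuit-realizes v inputs G) (circuit-realizes v inputs H)

  -- Choosing a disjunct with parallel or: if every true input of F names a disjunct
  -- realized by Id and F is true, some input throws a proof to the saved continuation.
  choose-realizes : ∀ n F {A : Fin (suc n) → FV} {θ} (v : Fin (suc n) → 𝔹) → ∣ POR ∣ θ →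
    (∀ p → T (v p) → ∣ A p ∣ Id) → T (evaluate F v) → ∣ ⋁ n A ∣ (app (choose n F) θ)
  choose-realizes n F {θ = θ} v θr disjuncts holds π π∈⋁ =
    closed (push ◅ β-closed _ θ π ◅◅ push ◅ save ◅ β-env (θ ∷ []) (circuit v1 leaf F) (k π) π)
      (transport Realizes⊥ (sym (subst-circuit env v1 leaf F)) (circuit-realizes v thrown F holds) π)
    where
    open PorGates θr
    leaf : Fin (suc n) → Term 2
    leaf p = app v0 (inject n p Id)
    env : Fin 2 → Λ
    env = k π ∷ θ ∷ []
    thrown : ∀ p → T (v p) → Realizes⊥ (subst env (leaf p))
    thrown p vp = transport (λ w → Realizes⊥ (app (k π) w)) (sym (subst-inject env n p Id))
      (throw (inject-realizes n p (disjuncts p vp) π π∈⋁))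

ℷ₂-bit : ∀ x → (x + 1) ⊓ 2 ≡ x + 1 → Σ (Fin 2) λ i → toℕ i ≡ x
ℷ₂-bit zero          _ = zero , refl
ℷ₂-bit (suc zero)    _ = suc zero , refl
ℷ₂-bit (suc (suc x)) h with m⊓n≡m⇒m≤n h
... | s≤s (s≤s x+1≤0) with m+n≤o⇒n≤o x x+1≤0
... | ()

bit-ℷ₂ : ∀ (i : Fin 2) → (toℕ i + 1) ⊓ 2 ≡ toℕ i + 1
bit-ℷ₂ zero       = refl
bit-ℷ₂ (suc zero) = refl

-- The ten pairs of five points, in the order of the disjunction in |ℷ₂| ≤ 4.
first second : Fin 10 → Fin 5
first  = # 0 ∷ # 0 ∷ # 0 ∷ # 0 ∷ # 1 ∷ # 1 ∷ # 1 ∷ # 2 ∷ # 2 ∷ # 3 ∷ []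
second = # 1 ∷ # 2 ∷ # 3 ∷ # 4 ∷ # 2 ∷ # 3 ∷ # 4 ∷ # 3 ∷ # 4 ∷ # 4 ∷ []

equalPairs : (Fin 5 → ℕ) → Fin 10 → 𝔹
equalPairs x p = x (first p) ≡ᵇ x (second p)

-- A majority circuit over the pairs that is true on every 2-colouring of five
-- points; eᵢⱼ is the input "xᵢ = xⱼ".  It exists because the equal-pair sets of
-- two colourings always intersect (pigeonhole on the four colour combinations),
-- and intersecting monotone families extend to self-dual monotone functions.
certificate : Maj (Fin 10)
certificate = maj
  (maj (maj (maj e14 e12 e25) (maj e14 e13 e23) e12)
       (maj (maj e35 (maj e15 e13 e12) e12) (maj e14 e34 e12) e13)
       (maj e35 (maj e24 e35 e14) (maj e24 e35 e12)))
  (maj (maj e15 (maj (maj e15 e24 e12) e15 e14) e35)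
       (maj e15 (maj e13 e35 e45) e45)
       (maj (maj e24 (maj e24 e12 e34) e45) e25 (maj e35 e34 (maj e34 e12 e24))))
  (maj (maj (maj e23 e34 e45) (maj e13 e15 e24) e45)
       (maj (maj e13 e14 e23) (maj e25 e23 e45) e13)
       (maj e25 e23 e34))
  where
  e12 e13 e14 e15 e23 e24 e25 e34 e35 e45 : Maj (Fin 10)
  e12 = input (# 0)
  e13 = input (# 1)
  e14 = input (# 2)
  e15 = input (# 3)
  e23 = input (# 4)
  e24 = input (# 5)
  e25 = input (# 6)
  e34 = input (# 7)
  e35 = input (# 8)
  e45 = input (# 9)

certificate-valid : ∀ (i₁ i₂ i₃ i₄ i₅ : Fin 2) →
  T (evaluate certificate (equalPairs (toℕ i₁ ∷ toℕ i₂ ∷ toℕ i₃ ∷ toℕ i₄ ∷ toℕ i₅ ∷ [])))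
certificate-valid = toWitness {a? = all? λ (i₁ : Fin 2) → all? λ (i₂ : Fin 2) → all? λ (i₃ : Fin 2) →
  all? λ (i₄ : Fin 2) → all? λ (i₅ : Fin 2) →
  T? (evaluate certificate (equalPairs (toℕ i₁ ∷ toℕ i₂ ∷ toℕ i₃ ∷ toℕ i₄ ∷ toℕ i₅ ∷ [])))} tt

-- The three candidates exposed by a refutation u • v • a • b • ρ of POR:
-- the terms b, u a b and v a b.
data Candidate : Set where
  cand-b cand-u cand-v : Candidate

_≟ᶜ_ : DecidableEquality Candidate
cand-b ≟ᶜ cand-b = yes refl
cand-b ≟ᶜ cand-u = no λ ()
cand-b ≟ᶜ cand-v = no λ ()
cand-u ≟ᶜ cand-b = no λ ()
cand-u ≟ᶜ cand-u = yes refl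
cand-u ≟ᶜ cand-v = no λ ()
cand-v ≟ᶜ cand-b = no λ ()
cand-v ≟ᶜ cand-u = no λ ()
cand-v ≟ᶜ cand-v = yes refl

label : Fin 10 → Candidate
label = cand-b ∷ cand-u ∷ cand-u ∷ cand-v ∷ cand-u ∷ cand-u ∷ cand-v ∷ cand-b ∷ cand-v ∷ cand-v ∷ []

avoiding : Candidate → Fin 5 → Fin 2
avoiding cand-b = # 0 ∷ # 1 ∷ # 0 ∷ # 1 ∷ # 0 ∷ []
avoiding cand-u = # 0 ∷ # 0 ∷ # 1 ∷ # 1 ∷ # 0 ∷ []
avoiding cand-v = # 0 ∷ # 0 ∷ # 0 ∷ # 0 ∷ # 1 ∷ []

Avoids : Candidate → Set
Avoids c = ∀ p → toℕ (avoiding c (first p)) ≡ toℕ (avoiding c (second p)) → label p ≢ c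

avoids? : ∀ c → Dec (Avoids c)
avoids? c = all? λ p → (toℕ (avoiding c (first p)) ≟ toℕ (avoiding c (second p))) →-dec ¬? (label p ≟ᶜ c)

avoids : ∀ c → Avoids c
avoids cand-b = toWitness {a? = avoids? cand-b} tt
avoids cand-u = toWitness {a? = avoids? cand-u} tt
avoids cand-v = toWitness {a? = avoids? cand-v} tt

-- The candidates as terms in the context τ, u, v, a, b.
candidate : Candidate → Term 5
candidate cand-b = v0
candidate cand-u = app (app v3 v1) v0
candidate cand-v = app (app v2 v1) v0

-- λτ.λu.λv.λa.λb. (cases over the pairs, pair p feeding its candidate) τ
porFromℷ₂ : Λ
porFromℷ₂ = lam (lam (lam (lam (lam (app (cases 9 (λ p → app Feed (candidate (label p)))) v4)))))

module _ (P : Pole) where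
  open Pole P
  open Realizability P
  open RealizabilityLemmas P

  PairEqual : (Fin 5 → ℕ) → Fin 10 → FV
  PairEqual x p = x (first p) ≗ x (second p)

  -- From a realizer θ of POR, choose 9 certificate θ realizes |ℷ₂| ≤ 4: the points
  -- are bits, and the certificate is true on their equal pairs.
  ℷ₂≤4-from-POR : ∀ {θ} → ∣ POR ∣ θ → ∣ ℷ₂≤4 ∣ (app (choose 9 certificate) θ)
  ℷ₂≤4-from-POR θr π (x₁ , x₂ , x₃ , x₄ , x₅ , lift h₁ , lift h₂ , lift h₃ , lift h₄ , lift h₅ , π∈⋁)
    with ℷ₂-bit x₁ h₁ | ℷ₂-bit x₂ h₂ | ℷ₂-bit x₃ h₃ | ℷ₂-bit x₄ h₄ | ℷ₂-bit x₅ h₅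
  ... | i₁ , refl | i₂ , refl | i₃ , refl | i₄ , refl | i₅ , refl =
    choose-realizes 9 certificate {A = PairEqual x} (equalPairs x) θr
      (λ p equal → refl-realizes (≡ᵇ⇒≡ _ _ equal)) (certificate-valid i₁ i₂ i₃ i₄ i₅) π π∈⋁
    where
    x : Fin 5 → ℕ
    x = toℕ i₁ ∷ toℕ i₂ ∷ toℕ i₃ ∷ toℕ i₄ ∷ toℕ i₅ ∷ []

  module _ {τ} (τr : ∣ ℷ₂≤4 ∣ τ) where
    Runs : Λ → Λ → Λ → Λ → Stack → Candidate → Set
    Runs u v a b ρ c′ = ⊥⊥ (subst (b ∷ a ∷ v ∷ u ∷ τ ∷ []) (candidate c′) ★ ρ)

    -- If every candidate except c runs, feed τ the colouring avoiding c: each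
    -- monochromatic pair then has a running candidate as its handler.
    refute : ∀ {u v a b ρ} c → (∀ c′ → c′ ≢ c → Runs u v a b ρ c′) →
      ⊥⊥ (app porFromℷ₂ τ ★ u • v • a • b • ρ)
    refute {u} {v} {a} {b} {ρ} c runs =
      closed (push ◅ β₅ _ τ u v a b ρ ◅◅ push ◅ ε)
        (cases-realizes 9 {A = PairEqual x} {Z = Only ρ} handler
          (λ p → feed-realizes ρ _ (λ equal → runs (label p) (avoids c p equal)))
          _ (τ , ρ , lift refl , τ∈⋁ , lift refl))
      where
      x : Fin 5 → ℕ
      x i = toℕ (avoiding c i)
      handler : Fin 10 → Λ
      handler p = app Feed (subst (b ∷ a ∷ v ∷ u ∷ τ ∷ []) (candidate (label p)))
      τ∈⋁ : ∣ ⋁ 9 (PairEqual x) ∣ τ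
      τ∈⋁ π π∈⋁ = τr π (x (# 0) , x (# 1) , x (# 2) , x (# 3) , x (# 4) ,
        lift (bit-ℷ₂ (avoiding c (# 0))) , lift (bit-ℷ₂ (avoiding c (# 1))) , lift (bit-ℷ₂ (avoiding c (# 2))) ,
        lift (bit-ℷ₂ (avoiding c (# 3))) , lift (bit-ℷ₂ (avoiding c (# 4))) , π∈⋁)

    -- porFromℷ₂ τ realizes POR: in each clause of POR two candidates run.
    POR-from-ℷ₂≤4 : ∣ POR ∣ (app porFromℷ₂ τ)
    POR-from-ℷ₂≤4 _ (inj₁ (inj₁ (u , _ , lift refl , ur , (v , _ , lift refl , _ ,
                      (X , a , _ , lift refl , ar , (b , ρ , lift refl , br , xρ)))))) = refute cand-v runs
      where
      runs : ∀ c → c ≢ cand-v → Runs u v a b ρ c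
      runs cand-b _   = br ρ xρ
      runs cand-u _   = bool-elim X ur ar br xρ
      runs cand-v c≢c = ⊥-elim (c≢c refl)
    POR-from-ℷ₂≤4 _ (inj₁ (inj₂ (u , _ , lift refl , _ , (v , _ , lift refl , vr ,
                      (X , a , _ , lift refl , ar , (b , ρ , lift refl , br , xρ)))))) = refute cand-u runs
      where
      runs : ∀ c → c ≢ cand-u → Runs u v a b ρ c
      runs cand-b _   = br ρ xρ
      runs cand-u c≢c = ⊥-elim (c≢c refl)
      runs cand-v _   = bool-elim X vr ar br xρ
    POR-from-ℷ₂≤4 _ (inj₂ (u , _ , lift refl , ur , (v , _ , lift refl , vr ,
                      (X , a , _ , lift refl , ar , (b , ρ , lift refl , br , xρ))))) = refute cand-b runs
      where
      runs : ∀ c → c ≢ cand-b → Runs u v a b ρ c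
      runs cand-b c≢c = ⊥-elim (c≢c refl)
      runs cand-u _   = bool-elim X ur ar br xρ
      runs cand-v _   = bool-elim X vr ar br xρ

mainTheorem3 : (𝒮 : RealizabilityStructure) →
    ((𝒮 ⊨ ℷ₂≤4formula) → (𝒮 ⊨ PORformula)) × ((𝒮 ⊨ PORformula) → (𝒮 ⊨ ℷ₂≤4formula))
mainTheorem3 𝒮 = POR-from , ℷ₂≤4-from
  where
  POR-from : 𝒮 ⊨ ℷ₂≤4formula → 𝒮 ⊨ PORformula
  POR-from (τ , τ-proofLike , τr) =
    app porFromℷ₂ τ , app (isProofLike-sound porFromℷ₂ tt) τ-proofLike ,
    λ P P∈𝒮 → POR-from-ℷ₂≤4 P (τr P P∈𝒮)

  ℷ₂≤4-from : 𝒮 ⊨ PORformula → 𝒮 ⊨ ℷ₂≤4formula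
  ℷ₂≤4-from (θ , θ-proofLike , θr) =
    app (choose 9 certificate) θ , app (isProofLike-sound (choose 9 certificate) tt) θ-proofLike ,
    λ P P∈𝒮 → ℷ₂≤4-from-POR P (θr P P∈𝒮)
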